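{- Let $\sigma=\sigma_1\cdots\sigma_k$ be a Cayley permutation with $k\ge 2$. Let $\pi$ be a Cayley permutation and let $\gamma=\mathcal{R}(\mathcal{S}^{\sigma}(\pi))$. Then: (1) if $\sigma_1=\sigma_2$, then $P_\sigma(\pi)=\mathcal{R}(P_\sigma(\gamma))$; (2) if $P_\sigma(\pi)=\mathcal{R}(P_\sigma(\gamma))$, then $(\mathcal{R}\circ\mathcal{S}^{\sigma})^2(\pi)=\pi$.
   Context: A Cayley permutation is a finite word $\pi=\pi_1\cdots\pi_n$ over the positive integers such that every integer from $1$ to $\max(\pi)$ occurs at least once. A word contains a pattern $p=p_1\cdots p_k$ if it has a subsequence $x_{i_1}\cdots x_{i_k}$ with $x_{i_u}<x_{i_v}$ iff $p_u<p_v$ and $x_{i_u}=x_{i_v}$ iff $p_u=p_v$; otherwise it avoids $p$. For a word $w$, $\mathcal{R}(w)$ is its reverse. A $\sigma$-stack processes an input word from left to right with the following right-greedy algorithm: while the input is nonempty, if pushing the next input element onto the stack yields stack contents which, read from top to bottom, avoid $\sigma$, the element is pushed; otherwise the top element is popped and appended to the output. When the input is exhausted, the remaining elements are popped one by one. $\mathcal{S}^{\sigma}(\pi)$ denotes the output on input $\pi$. $P_\sigma(\pi)$ is the Dyck path (word in the steps $U=(1,1)$ and $D=(1,-1)$ starting at the origin, never going below the $x$-axis and ending on it) obtained by recording, in order, each push performed while processing $\pi$ with the $\sigma$-stack as a step $U$ and each pop as a step $D$. For a Dyck path $P$ of length $2n$, $\mathcal{R}(P)$ denotes its reflection in the vertical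 line $x=n$ (equivalently, reverse the word of steps and exchange $U$ and $D$). -}

module Defs where

open import Data.Nat using (ℕ; zero; suc; _≤_; _⊔_; _<ᵇ_; _≡ᵇ_)
open import Data.Bool using (Bool; true; false; _∧_; if_then_else_)
open import Data.Bool.Properties using () renaming (_≟_ to _≟B_)
open import Data.List using (List; []; _∷_; _++_; map; reverse; foldr; zip; length)
open import Data.Bool.ListAction using (any; all)
open import Data.List.Membership.Propositional using (_∈_)
open import Data.List.Relation.Unary.All using (All)
open import Data.Product using (_×_; _,_; proj₁; proj₂)

-- Words over the positive integers are lists of naturals.
Word : Set
Word = List ℕ

maxW : Word → ℕ
maxW = foldr _⊔_ 0

IsCayley : Word → Set
IsCayley w = All (λ x → 1 ≤ x) w × (∀ i → 1 ≤ i → i ≤ maxW w → i ∈ w)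

_==_ : Bool → Bool → Bool
true == true = true
false == false = true
_ == _ = false

sameOrder : ℕ → ℕ → ℕ → ℕ → Bool
sameOrder a b x y = ((a <ᵇ b) == (x <ᵇ y)) ∧ ((a ≡ᵇ b) == (x ≡ᵇ y))

orderIso : Word → Word → Bool
orderIso [] [] = true
orderIso (a ∷ as) (x ∷ xs) =
  all (λ bq → sameOrder a (proj₁ bq) x (proj₂ bq)) (zip as xs) ∧ orderIso as xs
orderIso _ _ = false

subseqs : Word → List Word
subseqs [] = [] ∷ []
subseqs (x ∷ xs) = let r = subseqs xs in map (x ∷_) r ++ r

containsᵇ : Word → Word → Bool
containsᵇ w p = any (orderIso p) (subseqs w)

avoidsᵇ : Word → Word → Bool
avoidsᵇ w p = if containsᵇ w p then false else true

-- Dyck path steps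
data Step : Set where
  U D : Step

flipStep : Step → Step
flipStep U = D
flipStep D = U

-- reflection of a Dyck path in the vertical line through its midpoint
reflectPath : List Step → List Step
reflectPath P = map flipStep (reverse P)

-- Stack is a list, head = top. Inserting x into stack s:
-- pop while pushing x would create an occurrence of σ (stack read top to bottom),
-- then push. Returns (popped elements in output order, steps, new stack).
-- (If the stack is empty, x is pushed; for |σ| ≥ 2 a one-letter stack always avoids σ.)
insert : Word → ℕ → Word → Word × List Step × Word
insert σ x [] = [] , U ∷ [] , x ∷ []
insert σ x (y ∷ s) with avoidsᵇ (x ∷ y ∷ s) σ
... | true = [] , U ∷ [] , x ∷ y ∷ s
... | false with insert σ x s
...   | out , st , s' = y ∷ out , D ∷ st , s'

run : Word → Word → Word → Word × List Step
run σ [] s = s , map (λ _ → D) s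
run σ (x ∷ xs) s with insert σ x s
... | out , st , s' with run σ xs s'
...   | out' , st' = out ++ out' , st ++ st'

stackSort : Word → Word → Word
stackSort σ π = proj₁ (run σ π [])

stackPath : Word → Word → List Step
stackPath σ π = proj₂ (run σ π [])

module Submission where

open import Defs
open import Data.Nat using (ℕ; _≡ᵇ_)
open import Data.Nat.Properties using (≡ᵇ⇒≡; ≡⇒≡ᵇ)
open import Data.Bool using (true; false; T)
open import Data.Bool.Properties using (T-∧)
open import Data.List using (List; []; _∷_; _++_; map; reverse; _ʳ++_)
open import Data.List.Properties using (reverse-map; reverse-involutive; map-∘; map-id; map-cong)
open import Data.List.Membership.Propositional using (_∈_; find; lose)
open import Data.List.Membership.Propositional.Properties using (∈-map⁺; ∈-map⁻; ∈-++⁺ˡ; ∈-++⁺ʳ; ∈-++⁻)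
open import Data.List.Relation.Unary.Any using (here)
open import Data.List.Relation.Unary.Any.Properties using (any⁺; any⁻)
open import Data.List.Relation.Binary.Sublist.Propositional using (_⊆_; []; _∷_; _∷ʳ_; ⊆-refl; ⊆-trans)
open import Data.Product using (_×_; _,_; proj₁; proj₂; ∃-syntax)
open import Data.Sum using (inj₁; inj₂)
open import Data.Empty using (⊥-elim)
open import Data.Unit using (⊤)
open import Function using (_∘_; id; Equivalence)
open import Relation.Nullary using (¬_)
open import Relation.Binary.PropositionalEquality

-- Record a σ-stack run as its sequence of moves. Read backwards with pushes and
-- pops exchanged, it is a legal run on the reversed output that outputs the
-- reversed input, passing through the same stack contents at mirrored times.
-- A run is determined by its input and its moves, so if the mirrored moves are
-- those of the actual run on γ, that run outputs R(π), which is (2).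
-- The actual run is the unique greedy one. When σ₁ = σ₂, containing σ does not
-- depend on the order of the two top stack entries, so a pop of y forced by the
-- incoming x (x y s contains σ) mirrors to a push of y after which x is forced
-- off (y x s contains σ): the mirrored run is greedy too, which is (1).

Contains : Word → Word → Set
Contains w p = ∃[ u ] u ⊆ w × T (orderIso p u)

⊆⇒∈-subseqs : ∀ {u w} → u ⊆ w → u ∈ subseqs w
⊆⇒∈-subseqs [] = here refl
⊆⇒∈-subseqs (x ∷ʳ u⊆w) = ∈-++⁺ʳ _ (⊆⇒∈-subseqs u⊆w)
⊆⇒∈-subseqs (refl ∷ u⊆w) = ∈-++⁺ˡ (∈-map⁺ (_ ∷_) (⊆⇒∈-subseqs u⊆w))

∈-subseqs⇒⊆ : ∀ {u} w → u ∈ subseqs w → u ⊆ w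
∈-subseqs⇒⊆ [] (here refl) = []
∈-subseqs⇒⊆ (x ∷ w) u∈ with ∈-++⁻ (map (x ∷_) (subseqs w)) u∈
... | inj₂ u∈′ = x ∷ʳ ∈-subseqs⇒⊆ w u∈′
... | inj₁ u∈′ with ∈-map⁻ (x ∷_) u∈′
...   | v , v∈ , refl = refl ∷ ∈-subseqs⇒⊆ w v∈

containsᵇ⇒Contains : ∀ w p → T (containsᵇ w p) → Contains w p
containsᵇ⇒Contains w p t with find (any⁻ (orderIso p) (subseqs w) t)
... | u , u∈ , iso = u , ∈-subseqs⇒⊆ w u∈ , iso

Contains⇒containsᵇ : ∀ {w p} → Contains w p → T (containsᵇ w p)
Contains⇒containsᵇ (u , u⊆w , iso) = any⁺ _ (lose (⊆⇒∈-subseqs u⊆w) iso)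

avoidsᵇ≡false⇒Contains : ∀ w p → avoidsᵇ w p ≡ false → Contains w p
avoidsᵇ≡false⇒Contains w p eq with containsᵇ w p in c
... | true = containsᵇ⇒Contains w p (subst T (sym c) _)

avoidsᵇ≡true⇒¬Contains : ∀ w p → avoidsᵇ w p ≡ true → ¬ Contains w p
avoidsᵇ≡true⇒¬Contains w p eq wp with containsᵇ w p | Contains⇒containsᵇ {w} {p} wp
avoidsᵇ≡true⇒¬Contains w p () wp | true | _

Contains-mono : ∀ {u w p} → u ⊆ w → Contains u p → Contains w p
Contains-mono u⊆w (v , v⊆u , iso) = v , ⊆-trans v⊆u u⊆w , iso

sameOrder-diagonal : ∀ a x y → T (sameOrder a a x y) → x ≡ y
sameOrder-diagonal a x y t with a ≡ᵇ a | ≡⇒≡ᵇ a a refl | x ≡ᵇ y | ≡ᵇ⇒≡ x y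
... | true | _ | true  | eq = eq _
... | true | _ | false | _  = ⊥-elim (proj₂ (Equivalence.to T-∧ t))

Contains-swap : ∀ {a r x y s} → Contains (x ∷ y ∷ s) (a ∷ a ∷ r) → Contains (y ∷ x ∷ s) (a ∷ a ∷ r)
Contains-swap (u , x ∷ʳ (y ∷ʳ u⊆s) , iso) = u , y ∷ʳ (x ∷ʳ u⊆s) , iso
Contains-swap (u , x ∷ʳ (refl ∷ u⊆s) , iso) = u , refl ∷ (x ∷ʳ u⊆s) , iso
Contains-swap (u , refl ∷ (y ∷ʳ u⊆s) , iso) = u , y ∷ʳ (refl ∷ u⊆s) , iso
Contains-swap {a} {x = x} {y} (u , refl ∷ (refl ∷ u⊆s) , iso)
  with sameOrder-diagonal a x y (proj₁ (Equivalence.to T-∧ (proj₁ (Equivalence.to T-∧ iso))))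
... | refl = u , refl ∷ (refl ∷ u⊆s) , iso

flipStep-involutive : ∀ a → flipStep (flipStep a) ≡ a
flipStep-involutive U = refl
flipStep-involutive D = refl

reflectPath-involutive : ∀ P → reflectPath (reflectPath P) ≡ P
reflectPath-involutive P = begin
  map flipStep (reverse (map flipStep (reverse P))) ≡⟨ cong (map flipStep) (reverse-map flipStep (reverse P)) ⟨
  map flipStep (map flipStep (reverse (reverse P))) ≡⟨ map-∘ (reverse (reverse P)) ⟨
  map (flipStep ∘ flipStep) (reverse (reverse P))   ≡⟨ map-cong flipStep-involutive _ ⟩
  map id (reverse (reverse P))                      ≡⟨ map-id _ ⟩
  reverse (reverse P)                               ≡⟨ reverse-involutive P ⟩
  P                                                 ∎
  where open ≡-Reasoning

reflectPath≡map-ʳ++ : ∀ P → reflectPath P ≡ map flipStep P ʳ++ []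
reflectPath≡map-ʳ++ P = reverse-map flipStep P

data Execution : List Step → Word → Word → Word → Set where
  done : Execution [] [] [] []
  push : ∀ {P inp s o} x → Execution P inp (x ∷ s) o → Execution (U ∷ P) (x ∷ inp) s o
  pop  : ∀ {P inp s o} y → Execution P inp s o → Execution (D ∷ P) inp (y ∷ s) (y ∷ o)

execution-output-unique : ∀ {P inp s o o′} → Execution P inp s o → Execution P inp s o′ → o ≡ o′
execution-output-unique done       done        = refl
execution-output-unique (push x e) (push .x e′) = execution-output-unique e e′
execution-output-unique (pop y e)  (pop .y e′)  = cong (y ∷_) (execution-output-unique e e′)

execution-reverse-acc : ∀ {P inp s o P′ h o′} → Execution P inp s o → Execution P′ h s o′ →
  Execution (map flipStep P ʳ++ P′) (o ʳ++ h) [] (inp ʳ++ o′)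
execution-reverse-acc done       e′ = e′
execution-reverse-acc (push x e) e′ = execution-reverse-acc e (pop x e′)
execution-reverse-acc (pop y e)  e′ = execution-reverse-acc e (push y e′)

execution-reverse : ∀ {P inp o} → Execution P inp [] o → Execution (reflectPath P) (reverse o) [] (reverse inp)
execution-reverse {P} e =
  subst (λ Q → Execution Q _ _ _) (sym (reflectPath≡map-ʳ++ P)) (execution-reverse-acc e done)

module Greedy (σ : Word) where

  CanPush : ℕ → Word → Set
  CanPush x []      = ⊤
  CanPush x (y ∷ s) = ¬ Contains (x ∷ y ∷ s) σ

  MustPop : Word → ℕ → Word → Set
  MustPop []      y s = ⊤
  MustPop (x ∷ _) y s = Contains (x ∷ y ∷ s) σ

  data GreedyExecution : List Step → Word → Word → Word → Set where
    done : GreedyExecution [] [] [] []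
    push : ∀ {P inp s o} x → CanPush x s →
           GreedyExecution P inp (x ∷ s) o → GreedyExecution (U ∷ P) (x ∷ inp) s o
    pop  : ∀ {P inp s o} y → MustPop inp y s →
           GreedyExecution P inp s o → GreedyExecution (D ∷ P) inp (y ∷ s) (y ∷ o)

  greedy⇒execution : ∀ {P inp s o} → GreedyExecution P inp s o → Execution P inp s o
  greedy⇒execution done         = done
  greedy⇒execution (push x _ g) = push x (greedy⇒execution g)
  greedy⇒execution (pop y _ g)  = pop y (greedy⇒execution g)

  greedy-unique : ∀ {P P′ inp s o o′} →
    GreedyExecution P inp s o → GreedyExecution P′ inp s o′ → P ≡ P′ × o ≡ o′
  greedy-unique done done = refl , refl
  greedy-unique (push x _ g) (push .x _ g′) with greedy-unique g g′
  ... | refl , refl = refl , refl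
  greedy-unique (pop y _ g) (pop .y _ g′) with greedy-unique g g′
  ... | refl , refl = refl , refl
  greedy-unique (push x can g) (pop y must g′) = ⊥-elim (can must)
  greedy-unique (pop y must g) (push x can g′) = ⊥-elim (can must)

  insert-greedy : ∀ x s {P inp o} → let (out , steps , s′) = insert σ x s in
    GreedyExecution P inp s′ o → GreedyExecution (steps ++ P) (x ∷ inp) s (out ++ o)
  insert-greedy x [] g = push x _ g
  insert-greedy x (y ∷ s) g with avoidsᵇ (x ∷ y ∷ s) σ in avoids
  ... | true  = push x (avoidsᵇ≡true⇒¬Contains _ σ avoids) g
  ... | false with insert σ x s | insert-greedy x s
  ...   | _ , _ , _ | ih = pop y (avoidsᵇ≡false⇒Contains _ σ avoids) (ih g)

  run-greedy : ∀ inp s → let (o , P) = run σ inp s in GreedyExecution P inp s o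
  run-greedy []       []      = done
  run-greedy []       (y ∷ s) = pop y _ (run-greedy [] s)
  run-greedy (x ∷ xs) s with insert σ x s | insert-greedy x s
  ... | _ , _ , s′ | ins with run σ xs s′ | run-greedy xs s′
  ...   | _ , _ | g = ins g

  stackSort-execution : ∀ π → Execution (stackPath σ π) π [] (stackSort σ π)
  stackSort-execution π = greedy⇒execution (run-greedy π [])

  LegalStack : Word → Set
  LegalStack []      = ⊤
  LegalStack (y ∷ s) = CanPush y s × LegalStack s

  -- The mirrored run will pop the next forward input x off x ∷ s while h is
  -- still to be read; this says that pop is forced.
  MirrorMustPop : Word → Word → Word → Set
  MirrorMustPop h []      s = ⊤
  MirrorMustPop h (x ∷ _) s = MustPop h x s

  SwapInvariant : Set
  SwapInvariant = ∀ {x y s} → Contains (x ∷ y ∷ s) σ → Contains (y ∷ x ∷ s) σ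

  -- The last execution is the mirror of the part of the forward run already done;
  -- ʳ++ makes every step of the induction definitional.
  greedy-reverse-acc : SwapInvariant → ∀ {P inp s o P′ h o′} →
    GreedyExecution P inp s o → LegalStack s → MirrorMustPop h inp s → GreedyExecution P′ h s o′ →
    GreedyExecution (map flipStep P ʳ++ P′) (o ʳ++ h) [] (inp ʳ++ o′)
  greedy-reverse-acc swap done _ _ g′ = g′
  greedy-reverse-acc swap {inp = x ∷ inp} {h = h} (push x can g) legal must g′ =
    greedy-reverse-acc swap g (can , legal) (mustPop-below inp h must) (pop x must g′)
    where
    mustPop-below : ∀ inp h → MustPop h x _ → MirrorMustPop h inp (x ∷ _)
    mustPop-below []      h       _ = _
    mustPop-below (_ ∷ _) []      _ = _
    mustPop-below (x′ ∷ _) (_ ∷ _) c = Contains-mono {p = σ} (refl ∷ (x′ ∷ʳ ⊆-refl)) c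
  greedy-reverse-acc swap {inp = inp} (pop y must g) (can , legal) _ g′ =
    greedy-reverse-acc swap g legal (swapped inp must) (push y can g′)
    where
    swapped : ∀ inp → MustPop inp y _ → MirrorMustPop (y ∷ _) inp _
    swapped []      _ = _
    swapped (_ ∷ _) c = swap c

  greedy-reverse : SwapInvariant → ∀ {P inp o} → GreedyExecution P inp [] o →
    GreedyExecution (reflectPath P) (reverse o) [] (reverse inp)
  greedy-reverse swap {P} {inp} g =
    subst (λ Q → GreedyExecution Q _ _ _) (sym (reflectPath≡map-ʳ++ P))
      (greedy-reverse-acc swap g _ (nothing-mirrored inp) done)
    where
    nothing-mirrored : ∀ inp → MirrorMustPop [] inp []
    nothing-mirrored []      = _
    nothing-mirrored (_ ∷ _) = _

reverseSort : Word → Word → Word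
reverseSort σ π = reverse (stackSort σ π)

stackPath-reverseSort : ∀ σ → Greedy.SwapInvariant σ → ∀ π →
  stackPath σ π ≡ reflectPath (stackPath σ (reverseSort σ π))
stackPath-reverseSort σ swap π = begin
  stackPath σ π                                ≡⟨ reflectPath-involutive _ ⟨
  reflectPath (reflectPath (stackPath σ π))    ≡⟨ cong reflectPath mirrored-path ⟩
  reflectPath (stackPath σ (reverseSort σ π))  ∎
  where
  open ≡-Reasoning
  open Greedy σ
  mirrored-path : reflectPath (stackPath σ π) ≡ stackPath σ (reverseSort σ π)
  mirrored-path = proj₁ (greedy-unique (greedy-reverse swap (run-greedy π [])) (run-greedy (reverseSort σ π) []))

reverseSort-involutive : ∀ σ π → stackPath σ π ≡ reflectPath (stackPath σ (reverseSort σ π)) →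
  reverseSort σ (reverseSort σ π) ≡ π
reverseSort-involutive σ π mirrored = begin
  reverse (stackSort σ γ) ≡⟨ cong reverse (execution-output-unique (stackSort-execution γ) reversed) ⟩
  reverse (reverse π)     ≡⟨ reverse-involutive π ⟩
  π                       ∎
  where
  open ≡-Reasoning
  open Greedy σ
  γ : Word
  γ = reverseSort σ π
  reversed : Execution (stackPath σ γ) γ [] (reverse π)
  reversed = subst (λ Q → Execution Q γ [] (reverse π))
    (trans (cong reflectPath mirrored) (reflectPath-involutive _))
    (execution-reverse (stackSort-execution π))

theorem8 : (s₁ s₂ : ℕ) (rest : List ℕ) (π : List ℕ) →
    IsCayley (s₁ ∷ s₂ ∷ rest) → IsCayley π →
    ((s₁ ≡ s₂ →
        stackPath (s₁ ∷ s₂ ∷ rest) π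
          ≡ reflectPath (stackPath (s₁ ∷ s₂ ∷ rest) (reverse (stackSort (s₁ ∷ s₂ ∷ rest) π))))
    × (stackPath (s₁ ∷ s₂ ∷ rest) π
          ≡ reflectPath (stackPath (s₁ ∷ s₂ ∷ rest) (reverse (stackSort (s₁ ∷ s₂ ∷ rest) π))) →
        reverse (stackSort (s₁ ∷ s₂ ∷ rest)
          (reverse (stackSort (s₁ ∷ s₂ ∷ rest) π))) ≡ π))
theorem8 s₁ s₂ rest π _ _ =
  (λ { refl → stackPath-reverseSort (s₁ ∷ s₁ ∷ rest) Contains-swap π }) ,
  reverseSort-involutive (s₁ ∷ s₂ ∷ rest) π
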